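{- Define words over $\{0,1\}$ by $\Lambda_0=1$, $\Lambda_1=01$ and $\Lambda_n=\Lambda_{n-2}\Lambda_{n-1}$ for $n\ge 2$. Then the infinite word $\Lambda_0\Lambda_1\Lambda_2\cdots$ is equal to the infinite Fibonacci word with the letters $0$ and $1$ interchanged.
   Context: The Fibonacci morphism is the monoid morphism $\varphi:\{0,1\}^*\to\{0,1\}^*$ with $\varphi(0)=01$, $\varphi(1)=0$. The infinite Fibonacci word $\varphi^{\omega}(0)=010010100100101\cdots$ is the unique infinite word that is a fixed point of $\varphi$. -}

module Defs where

open import Data.Nat using (ℕ; zero; suc)
open import Data.List using (List; []; _∷_; _++_; concatMap)

data Bit : Set where
  b0 b1 : Bit

Word : Set
Word = List Bit

InfWord : Set
InfWord = ℕ → Bit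

φ₁ : Bit → Word
φ₁ b0 = b0 ∷ b1 ∷ []
φ₁ b1 = b0 ∷ []

φ : Word → Word
φ = concatMap φ₁

φ^ : ℕ → Word → Word
φ^ zero w = w
φ^ (suc n) w = φ (φ^ n w)

-- i-th letter (0-based) of a finite word, with a default letter if out of range
at : Word → ℕ → Bit
at [] _ = b0
at (x ∷ w) zero = x
at (x ∷ w) (suc i) = at w i

-- the infinite Fibonacci word φ^ω(0) = lim φⁿ(0): its i-th letter is the i-th
-- letter of φ^(i+1)(0), which has length ≥ i+1 (and φⁿ(0) is a prefix of φⁿ⁺¹(0))
fibWord : InfWord
fibWord i = at (φ^ (suc i) (b0 ∷ [])) i

swap : Bit → Bit
swap b0 = b1
swap b1 = b0

Λ : ℕ → Word
Λ zero = b1 ∷ []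
Λ (suc zero) = b0 ∷ b1 ∷ []
Λ (suc (suc n)) = Λ n ++ Λ (suc n)

ΛPrefix : ℕ → Word
ΛPrefix zero = Λ zero
ΛPrefix (suc n) = ΛPrefix n ++ Λ (suc n)

-- the infinite word Λ₀ Λ₁ Λ₂ ⋯ : its i-th letter is the i-th letter of Λ₀⋯Λᵢ
-- (which has length ≥ i+1 since every Λₙ is nonempty)
ΛWord : InfWord
ΛWord i = at (ΛPrefix i) i

module Submission where

-- Write fₙ = φⁿ(0) for the finite Fibonacci words and f̄ₙ for fₙ with its
-- letters swapped; they satisfy fₙ₊₂ = fₙ₊₁fₙ, and the i-th letter of φ^ω(0)
-- is the i-th letter of fᵢ₊₁.  Let dₙ be the two-letter word 01 for even n and 10 for odd n (the
-- last two letters of f̄ₙ₊₂).  The heart of the proof is the conjugacy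
--     Λₙ dₙ = dₙ₊₁ f̄ₙ                                          (conjugacy)
-- proved by a three-step induction from the "unfolded" recursions
-- f̄ₙ₊₃ = f̄ₙ₊₁f̄ₙf̄ₙ₊₁ and Λₙ₊₃ = Λₙ₊₁ΛₙΛₙ₊₁.  Telescoping it gives
--     Λ₀Λ₁⋯Λₙ dₙ = f̄ₙ₊₂,                                        (prefix)
-- so Λ₀⋯Λₙ is a prefix of f̄ₙ₊₂ = f̄ₙ₊₁f̄ₙ.  The theorem follows by reading the
-- i-th letter, once we know that Λ₀⋯Λᵢ and fᵢ₊₁ are long enough.

open import Defs
open import Data.Nat using (ℕ; zero; suc; _≤_; _<_; s≤s; z≤n)
open import Data.Nat.Properties using (≤-trans; n≤1+n; +-identityʳ; +-mono-≤-<)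
open import Data.List using ([]; _∷_; _++_; map; length)
open import Data.List.Properties using (++-assoc; concatMap-++; map-++; length-++; length-++-≤ˡ; length-map)
open import Relation.Binary.PropositionalEquality using (_≡_; refl; sym; trans; cong; subst; subst₂)
open Relation.Binary.PropositionalEquality.≡-Reasoning

at-++ : ∀ u v {i} → i < length u → at (u ++ v) i ≡ at u i
at-++ (x ∷ u) v {zero}  _         = refl
at-++ (x ∷ u) v {suc i} (s≤s i<u) = at-++ u v i<u

at-map : ∀ (g : Bit → Bit) u {i} → i < length u → at (map g u) i ≡ g (at u i)
at-map g (x ∷ u) {zero}  _         = refl
at-map g (x ∷ u) {suc i} (s≤s i<u) = at-map g u i<u

length-++-grows : ∀ {m} (u v : Word) → m ≤ length u → 0 < length v → m < length (u ++ v)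
length-++-grows {m} u v m≤u 0<v =
  subst₂ _<_ (+-identityʳ m) (sym (length-++ u {v})) (+-mono-≤-< m≤u 0<v)

φ^-++ : ∀ n u v → φ^ n (u ++ v) ≡ φ^ n u ++ φ^ n v
φ^-++ zero    u v = refl
φ^-++ (suc n) u v = trans (cong φ (φ^-++ n u v)) (concatMap-++ φ₁ (φ^ n u) (φ^ n v))

φ^-φ : ∀ n w → φ^ n (φ w) ≡ φ^ (suc n) w
φ^-φ zero    w = refl
φ^-φ (suc n) w = cong φ (φ^-φ n w)

fib : ℕ → Word
fib n = φ^ n (b0 ∷ [])

fib-rec : ∀ n → fib (suc (suc n)) ≡ fib (suc n) ++ fib n
fib-rec n = begin
  fib (suc (suc n))                        ≡⟨ sym (φ^-φ (suc n) (b0 ∷ [])) ⟩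
  φ^ (suc n) (φ (b0 ∷ []))                 ≡⟨ φ^-++ (suc n) (b0 ∷ []) (b1 ∷ []) ⟩
  fib (suc n) ++ φ^ (suc n) (b1 ∷ [])      ≡⟨ cong (fib (suc n) ++_) (sym (φ^-φ n (b1 ∷ []))) ⟩
  fib (suc n) ++ fib n                     ∎

fib-length : ∀ n → n < length (fib n)
fib-length zero          = s≤s z≤n
fib-length (suc zero)    = s≤s (s≤s z≤n)
fib-length (suc (suc n)) = subst (λ w → suc (suc n) < length w) (sym (fib-rec n))
  (length-++-grows (fib (suc n)) (fib n) (fib-length (suc n)) (≤-trans (s≤s z≤n) (fib-length n)))

fibSwap : ℕ → Word
fibSwap n = map swap (fib n)

fibSwap-rec : ∀ n → fibSwap (suc (suc n)) ≡ fibSwap (suc n) ++ fibSwap n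
fibSwap-rec n = trans (cong (map swap) (fib-rec n)) (map-++ swap (fib (suc n)) (fib n))

fibSwap-rec₃ : ∀ n → fibSwap (suc (suc (suc n))) ≡ fibSwap (suc n) ++ fibSwap n ++ fibSwap (suc n)
fibSwap-rec₃ n = begin
  fibSwap (suc (suc (suc n)))                           ≡⟨ fibSwap-rec (suc n) ⟩
  fibSwap (suc (suc n)) ++ fibSwap (suc n)              ≡⟨ cong (_++ fibSwap (suc n)) (fibSwap-rec n) ⟩
  (fibSwap (suc n) ++ fibSwap n) ++ fibSwap (suc n)     ≡⟨ ++-assoc (fibSwap (suc n)) (fibSwap n) (fibSwap (suc n)) ⟩
  fibSwap (suc n) ++ fibSwap n ++ fibSwap (suc n)       ∎

Λ-rec₃ : ∀ n → Λ (suc (suc (suc n))) ≡ Λ (suc n) ++ Λ n ++ Λ (suc n)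
Λ-rec₃ n = refl

-- Every Λₙ is nonempty (Λₙ₊₂ begins with Λₙ).
Λ-nonempty : ∀ n → 0 < length (Λ n)
Λ-nonempty zero          = s≤s z≤n
Λ-nonempty (suc zero)    = s≤s z≤n
Λ-nonempty (suc (suc n)) = ≤-trans (Λ-nonempty n) (length-++-≤ˡ (Λ n))

ΛPrefix-length : ∀ n → n < length (ΛPrefix n)
ΛPrefix-length zero    = s≤s z≤n
ΛPrefix-length (suc n) = length-++-grows (ΛPrefix n) (Λ (suc n)) (ΛPrefix-length n) (Λ-nonempty (suc n))

lastTwo : ℕ → Word
lastTwo zero          = b0 ∷ b1 ∷ []
lastTwo (suc zero)    = b1 ∷ b0 ∷ []
lastTwo (suc (suc n)) = lastTwo n

-- Λₙ dₙ = dₙ₊₁ f̄ₙ: moving dₙ₊₁ from the front of f̄ₙ to its back yields Λₙ.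
-- The case n + 3 uses the cases n + 1 (twice) and n, since dₙ₊₄ = dₙ and
-- dₙ₊₃ = dₙ₊₁; below d₀ = dₙ and d₁ = dₙ₊₁.
conjugacy : ∀ n → Λ n ++ lastTwo n ≡ lastTwo (suc n) ++ fibSwap n
conjugacy zero                = refl
conjugacy (suc zero)          = refl
conjugacy (suc (suc zero))    = refl
conjugacy (suc (suc (suc n))) = begin
  Λ (suc (suc (suc n))) ++ d₁                   ≡⟨ cong (_++ d₁) (Λ-rec₃ n) ⟩
  (Λ₁ ++ Λ₀ ++ Λ₁) ++ d₁                         ≡⟨ ++-assoc Λ₁ (Λ₀ ++ Λ₁) d₁ ⟩
  Λ₁ ++ (Λ₀ ++ Λ₁) ++ d₁                         ≡⟨ cong (Λ₁ ++_) (++-assoc Λ₀ Λ₁ d₁) ⟩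
  Λ₁ ++ Λ₀ ++ Λ₁ ++ d₁                           ≡⟨ cong (λ w → Λ₁ ++ Λ₀ ++ w) (conjugacy (suc n)) ⟩
  Λ₁ ++ Λ₀ ++ d₀ ++ f₁                           ≡⟨ cong (Λ₁ ++_) (sym (++-assoc Λ₀ d₀ f₁)) ⟩
  Λ₁ ++ (Λ₀ ++ d₀) ++ f₁                         ≡⟨ cong (λ w → Λ₁ ++ w ++ f₁) (conjugacy n) ⟩
  Λ₁ ++ (d₁ ++ f₀) ++ f₁                         ≡⟨ cong (Λ₁ ++_) (++-assoc d₁ f₀ f₁) ⟩
  Λ₁ ++ d₁ ++ f₀ ++ f₁                           ≡⟨ sym (++-assoc Λ₁ d₁ (f₀ ++ f₁)) ⟩
  (Λ₁ ++ d₁) ++ f₀ ++ f₁                         ≡⟨ cong (_++ f₀ ++ f₁) (conjugacy (suc n)) ⟩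
  (d₀ ++ f₁) ++ f₀ ++ f₁                         ≡⟨ ++-assoc d₀ f₁ (f₀ ++ f₁) ⟩
  d₀ ++ f₁ ++ f₀ ++ f₁                           ≡⟨ cong (d₀ ++_) (sym (fibSwap-rec₃ n)) ⟩
  d₀ ++ fibSwap (suc (suc (suc n)))              ∎
  where
  Λ₀ Λ₁ d₀ d₁ f₀ f₁ : Word
  Λ₀ = Λ n
  Λ₁ = Λ (suc n)
  d₀ = lastTwo n
  d₁ = lastTwo (suc n)
  f₀ = fibSwap n
  f₁ = fibSwap (suc n)

-- Telescoping the conjugacy: Λ₀Λ₁⋯Λₙ dₙ = f̄ₙ₊₂.
prefix : ∀ n → ΛPrefix n ++ lastTwo n ≡ fibSwap (suc (suc n))
prefix zero    = refl
prefix (suc n) = begin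
  (ΛPrefix n ++ Λ (suc n)) ++ lastTwo (suc n)          ≡⟨ ++-assoc (ΛPrefix n) (Λ (suc n)) (lastTwo (suc n)) ⟩
  ΛPrefix n ++ Λ (suc n) ++ lastTwo (suc n)            ≡⟨ cong (ΛPrefix n ++_) (conjugacy (suc n)) ⟩
  ΛPrefix n ++ lastTwo n ++ fibSwap (suc n)            ≡⟨ sym (++-assoc (ΛPrefix n) (lastTwo n) (fibSwap (suc n))) ⟩
  (ΛPrefix n ++ lastTwo n) ++ fibSwap (suc n)          ≡⟨ cong (_++ fibSwap (suc n)) (prefix n) ⟩
  fibSwap (suc (suc n)) ++ fibSwap (suc n)             ≡⟨ sym (fibSwap-rec (suc n)) ⟩
  fibSwap (suc (suc (suc n)))                          ∎

-- The theorem: read the i-th letter of Λ₀⋯Λᵢ inside f̄ᵢ₊₂ = f̄ᵢ₊₁ f̄ᵢ.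
mainTheorem2 : ∀ (i : ℕ) → ΛWord i ≡ swap (fibWord i)
mainTheorem2 i = begin
  at (ΛPrefix i) i                          ≡⟨ sym (at-++ (ΛPrefix i) (lastTwo i) (ΛPrefix-length i)) ⟩
  at (ΛPrefix i ++ lastTwo i) i             ≡⟨ cong (λ w → at w i) (prefix i) ⟩
  at (fibSwap (suc (suc i))) i              ≡⟨ cong (λ w → at w i) (fibSwap-rec i) ⟩
  at (fibSwap (suc i) ++ fibSwap i) i       ≡⟨ at-++ (fibSwap (suc i)) (fibSwap i) i<fibSwap ⟩
  at (map swap (fib (suc i))) i             ≡⟨ at-map swap (fib (suc i)) i<fib ⟩
  swap (at (fib (suc i)) i)                 ∎
  where
  i<fib : i < length (fib (suc i))
  i<fib = ≤-trans (n≤1+n (suc i)) (fib-length (suc i))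
  i<fibSwap : i < length (fibSwap (suc i))
  i<fibSwap = subst (i <_) (sym (length-map swap (fib (suc i)))) i<fib
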